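{- For $n\ge 5$: $\chi(\mathcal{Q}(n))=n$ when $n\equiv 1,5\pmod 6$; $\chi(\mathcal{Q}(n))\in\{n,n+1\}$ when $n\equiv 0,4\pmod 6$; $\chi(\mathcal{Q}(n))\in\{n,n+1,n+2,n+3\}$ when $n\equiv 2\pmod 6$; and $\chi(\mathcal{Q}(n))\in\{n,n+1,n+2\}$ when $n\equiv 3\pmod 6$.
   Context: The $n$-Queens' graph $\mathcal{Q}(n)$ has vertex set $[n]^2$ (squares of an $n\times n$ chessboard); two distinct vertices $(i,j),(p,q)$ are adjacent iff $i=p$, or $j=q$, or $i+j=p+q$, or $i-j=p-q$. $\chi$ denotes the chromatic number. -}

module Defs where

open import Data.Nat using (ℕ; _+_; _<_)
open import Data.Fin using (Fin; toℕ)
open import Data.Product using (_×_; _,_; ∃)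
open import Data.Sum using (_⊎_)
open import Relation.Binary.PropositionalEquality using (_≡_; _≢_)
open import Relation.Nullary using (¬_)

-- Squares of the n×n board (0-indexed; [n] = {1..n} shifted by one,
-- which does not affect adjacency).
Square : ℕ → Set
Square n = Fin n × Fin n

-- Adjacency in the n-Queens graph Q(n): distinct squares sharing a row,
-- column, sum-diagonal (i+j = p+q) or difference-diagonal (i-j = p-q,
-- written i+q = p+j to stay in ℕ).
QAdj : (n : ℕ) → Square n → Square n → Set
QAdj n (i , j) (p , q) =
  (i , j) ≢ (p , q) ×
  ( toℕ i ≡ toℕ p
  ⊎ toℕ j ≡ toℕ q
  ⊎ toℕ i + toℕ j ≡ toℕ p + toℕ q
  ⊎ toℕ i + toℕ q ≡ toℕ p + toℕ j )

ProperColouring : (n k : ℕ) → (Square n → Fin k) → Set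
ProperColouring n k c = ∀ u v → QAdj n u v → c u ≢ c v

Colourable : (n k : ℕ) → Set
Colourable n k = ∃ λ (c : Square n → Fin k) → ProperColouring n k c

ChromaticNumber : (n k : ℕ) → Set
ChromaticNumber n k = Colourable n k × (∀ m → m < k → ¬ Colourable n m)

-- Lower bound: the main diagonal is an n-clique.  Upper bound: when gcd(m, 6) = 1
-- the colouring (i, j) ↦ 2i + j mod m of Q(m) is proper, because moving d steps
-- along a row, column, anti-diagonal or diagonal changes 2i + j by d, 2d, d or 3d,
-- none of which vanishes mod m for 0 < d < m.  Q(n) is an induced subgraph of
-- Q(n + a), and n + 1, n + 3, n + 2 are prime to 6 when n ≡ 0 or 4, 2, 3 (mod 6)
-- respectively.  Colourability being decidable, the chromatic number is then the
-- least colourable value in the resulting interval.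
module Submission where

open import Defs
open import Data.Nat using (ℕ; _+_; _≤_; _%_)
open import Data.Product using (_×_; ∃)
open import Data.Sum using (_⊎_)
open import Relation.Binary.PropositionalEquality using (_≡_)

open import Data.Nat using (zero; suc; _*_; _/_; _<_; z≤n; s≤s; NonZero)
open import Data.Nat.Properties
  using (_≟_; ≤-total; +-comm; +-identityʳ; +-suc; +-assoc; +-cancelˡ-≡; m≤m+n; m≤n+m; ≤-<-trans;
         m≤n⇒∃[o]m+o≡n; m<1+n⇒m<n∨m≡n; <-irrefl)
open import Data.Nat.DivMod using (m≡m%n+[m/n]*n; m%n<n; %-distribˡ-+)
open import Data.Nat.Divisibility
  using (_∣_; divides; ∣-trans; ∣m+n∣m⇒∣n; n∣m*n; *-monoˡ-∣; >⇒∤; %-presˡ-∣; ∣1⇒≡1)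
open import Data.Nat.Coprimality using (Coprime; coprime-divisor)
open import Data.Nat.Tactic.RingSolver using (solve)
open import Data.Fin using (Fin; toℕ; fromℕ<; inject≤; combine; remQuot; finToFun; funToFin)
  renaming (_≟_ to _≟ᶠ_)
open import Data.Fin.Properties
  using (toℕ-inject≤; inject≤-injective; toℕ-injective; fromℕ<-injective; toℕ<n;
         remQuot-combine; finToFun-funToFin; pigeonhole; any?; all?)
open import Data.Product using (_,_; uncurry; map)
open import Data.Product.Properties using (≡-dec; ×-≡,≡→≡; ×-≡,≡←≡)
open import Data.Sum using (inj₁; inj₂)
open import Data.List using ([]; _∷_)
open import Function using (_∘_)
open import Relation.Nullary using (¬_; Dec; yes; no; contradiction)
open import Relation.Nullary.Decidable using (_×-dec_; _⊎-dec_; _→-dec_; ¬?; map′)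
open import Relation.Unary using (Pred; Decidable)
open import Relation.Binary using (Rel; Symmetric)
open import Relation.Binary.Consequences using (wlog)
open import Relation.Binary.PropositionalEquality
  using (_≢_; _≗_; refl; sym; trans; cong; subst; module ≡-Reasoning)

[m+n]%o≡m%o⇒o∣n : ∀ m n o .{{_ : NonZero o}} → (m + n) % o ≡ m % o → o ∣ n
[m+n]%o≡m%o⇒o∣n m n o eq =
  ∣m+n∣m⇒∣n (divides ((m + n) / o) (+-cancelˡ-≡ (m % o) _ _ expand)) (n∣m*n (m / o))
  where
  open ≡-Reasoning
  expand : m % o + (m / o * o + n) ≡ m % o + (m + n) / o * o
  expand = begin
    m % o + (m / o * o + n)        ≡⟨ +-assoc (m % o) _ n ⟨
    m % o + m / o * o + n          ≡⟨ cong (_+ n) (m≡m%n+[m/n]*n m o) ⟨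
    m + n                          ≡⟨ m≡m%n+[m/n]*n (m + n) o ⟩
    (m + n) % o + (m + n) / o * o  ≡⟨ cong (_+ (m + n) / o * o) eq ⟩
    m % o + (m + n) / o * o        ∎

m%o≡r⇒[m+n]%o≡[r+n%o]%o : ∀ m n o .{{_ : NonZero o}} {r} → m % o ≡ r → (m + n) % o ≡ (r + n % o) % o
m%o≡r⇒[m+n]%o≡[r+n%o]%o m n o m%o≡r =
  trans (%-distribˡ-+ m n o) (cong (λ r → (r + n % o) % o) m%o≡r)

∣∧<⇒≡0 : ∀ {m n} → m ∣ n → n < m → n ≡ 0
∣∧<⇒≡0 {n = zero}  _   _   = refl
∣∧<⇒≡0 {n = suc _} m∣n n<m = contradiction m∣n (>⇒∤ n<m)

%6≡1⊎5⇒coprime[n,6] : ∀ {n} → n % 6 ≡ 1 ⊎ n % 6 ≡ 5 → Coprime n 6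
%6≡1⊎5⇒coprime[n,6] {n} n%6 {d} (d∣n , d∣6) = ∣1⇒≡1 (d∣1 n%6)
  where
  d∣n%6 : d ∣ n % 6
  d∣n%6 = %-presˡ-∣ d∣n d∣6
  d∣1 : n % 6 ≡ 1 ⊎ n % 6 ≡ 5 → d ∣ 1
  d∣1 (inj₁ eq) = subst (d ∣_) eq d∣n%6
  d∣1 (inj₂ eq) = ∣m+n∣m⇒∣n d∣6 (subst (d ∣_) eq d∣n%6)

m≡n∧m+o≡n+p⇒o≡p : ∀ {m n o p} → m ≡ n → m + o ≡ n + p → o ≡ p
m≡n∧m+o≡n+p⇒o≡p {m} refl = +-cancelˡ-≡ m _ _

n≡0⇒m≡m+n : ∀ m {n} → n ≡ 0 → m ≡ m + n
n≡0⇒m≡m+n m refl = sym (+-identityʳ m)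

wlog-+ : ∀ {ℓ} {Q : Rel ℕ ℓ} → Symmetric Q → (∀ m d → Q m (m + d)) → ∀ m n → Q m n
wlog-+ {Q = Q} sym-Q Q-+ = wlog ≤-total sym-Q ordered
  where
  ordered : ∀ m n → m ≤ n → Q m n
  ordered m n m≤n with m≤n⇒∃[o]m+o≡n m≤n
  ... | d , refl = Q-+ m d

¬colourable-< : ∀ {n m} → m < n → ¬ Colourable n m
¬colourable-< m<n (c , proper) with pigeonhole m<n (λ i → c (i , i))
... | i , j , i<j , same =
  proper (i , i) (j , j) (i,i≢j,j , inj₂ (inj₂ (inj₂ (+-comm (toℕ i) (toℕ j))))) same
  where
  i,i≢j,j : (i , i) ≢ (j , j)
  i,i≢j,j refl = <-irrefl refl i<j

Collinear : ℕ → ℕ → ℕ → ℕ → Set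
Collinear i j p q = i ≡ p ⊎ j ≡ q ⊎ i + j ≡ p + q ⊎ i + q ≡ p + j

module LinearColouring {m : ℕ} .{{_ : NonZero m}} (m⊥6 : Coprime m 6) where

  value : ℕ → ℕ → ℕ
  value i j = (2 * i + j) % m

  k∣6∧[x+kd]≡x⇒d≡0 : ∀ k x y d → k ∣ 6 → d < m → y ≡ x + k * d → x % m ≡ y % m → d ≡ 0
  k∣6∧[x+kd]≡x⇒d≡0 k x y d k∣6 d<m refl eq = ∣∧<⇒≡0 m∣d d<m
    where
    m∣d : m ∣ d
    m∣d = coprime-divisor m⊥6 (∣-trans ([m+n]%o≡m%o⇒o∣n x (k * d) m (sym eq)) (*-monoˡ-∣ d k∣6))

  same-row : ∀ i j q → j < m → q < m → value i j ≡ value i q → j ≡ q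
  same-row i = wlog-+ (λ f q<m j<m eq → sym (f j<m q<m (sym eq))) shifted
    where
    shifted : ∀ j d → j < m → j + d < m → value i j ≡ value i (j + d) → j ≡ j + d
    shifted j d _ j+d<m = n≡0⇒m≡m+n j ∘ k∣6∧[x+kd]≡x⇒d≡0 1 (2 * i + j) (2 * i + (j + d)) d
      (divides 6 refl) (≤-<-trans (m≤n+m d j) j+d<m) (solve (i ∷ j ∷ d ∷ []))

  same-column : ∀ j i p → i < m → p < m → value i j ≡ value p j → i ≡ p
  same-column j = wlog-+ (λ f p<m i<m eq → sym (f i<m p<m (sym eq))) shifted
    where
    shifted : ∀ i d → i < m → i + d < m → value i j ≡ value (i + d) j → i ≡ i + d
    shifted i d _ i+d<m = n≡0⇒m≡m+n i ∘ k∣6∧[x+kd]≡x⇒d≡0 2 (2 * i + j) (2 * (i + d) + j) d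
      (divides 3 refl) (≤-<-trans (m≤n+m d i) i+d<m) (solve (i ∷ j ∷ d ∷ []))

  same-antidiagonal : ∀ i p j q → i < m → p < m → i + j ≡ p + q → value i j ≡ value p q → i ≡ p
  same-antidiagonal = wlog-+ (λ f j q p<m i<m s eq → sym (f q j i<m p<m (sym s) (sym eq))) shifted
    where
    shifted : ∀ i d j q → i < m → i + d < m → i + j ≡ i + d + q →
              value i j ≡ value (i + d) q → i ≡ i + d
    shifted i d j q _ i+d<m s with +-cancelˡ-≡ i j (d + q) (trans s (+-assoc i d q))
    ... | refl = n≡0⇒m≡m+n i ∘ k∣6∧[x+kd]≡x⇒d≡0 1 (2 * i + (d + q)) (2 * (i + d) + q) d
      (divides 6 refl) (≤-<-trans (m≤n+m d i) i+d<m) (solve (i ∷ q ∷ d ∷ []))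

  same-diagonal : ∀ i p j q → i < m → p < m → i + q ≡ p + j → value i j ≡ value p q → i ≡ p
  same-diagonal = wlog-+ (λ f j q p<m i<m s eq → sym (f q j i<m p<m (sym s) (sym eq))) shifted
    where
    shifted : ∀ i d j q → i < m → i + d < m → i + q ≡ i + d + j →
              value i j ≡ value (i + d) q → i ≡ i + d
    shifted i d j q _ i+d<m s with +-cancelˡ-≡ i q (d + j) (trans s (+-assoc i d j))
    ... | refl = n≡0⇒m≡m+n i ∘ k∣6∧[x+kd]≡x⇒d≡0 3 (2 * i + j) (2 * (i + d) + (d + j)) d
      (divides 2 refl) (≤-<-trans (m≤n+m d i) i+d<m) (solve (i ∷ j ∷ d ∷ []))

  collinear-value-injective : ∀ {i j p q} → i < m → j < m → p < m → q < m →
                              Collinear i j p q → value i j ≡ value p q → i ≡ p × j ≡ q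
  collinear-value-injective {i} {j} {p} {q} i<m j<m p<m q<m line eq with line
  ... | inj₁ refl = refl , same-row i j q j<m q<m eq
  ... | inj₂ (inj₁ refl) = same-column j i p i<m p<m eq , refl
  ... | inj₂ (inj₂ (inj₁ s)) = let i≡p = same-antidiagonal i p j q i<m p<m s eq
                                in i≡p , m≡n∧m+o≡n+p⇒o≡p i≡p s
  ... | inj₂ (inj₂ (inj₂ s)) = let i≡p = same-diagonal i p j q i<m p<m s eq
                                in i≡p , sym (m≡n∧m+o≡n+p⇒o≡p i≡p s)

  colour : Square m → Fin m
  colour (i , j) = fromℕ< (m%n<n (2 * toℕ i + toℕ j) m)

  colour-proper : ProperColouring m m colour
  colour-proper (i , j) (p , q) (distinct , line) same =
    distinct (×-≡,≡→≡ (map toℕ-injective toℕ-injective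
      (collinear-value-injective (toℕ<n i) (toℕ<n j) (toℕ<n p) (toℕ<n q) line
        (fromℕ<-injective _ _ _ _ same))))

coprime[n,6]⇒colourable : ∀ {n} .{{_ : NonZero n}} → Coprime n 6 → Colourable n n
coprime[n,6]⇒colourable n⊥6 = colour , colour-proper
  where open LinearColouring n⊥6

colourable-restrict : ∀ {m n k} → m ≤ n → Colourable n k → Colourable m k
colourable-restrict {m} {n} {k} m≤n (c , proper) = c ∘ embed , proper-embed
  where
  ι : Fin m → Fin n
  ι i = inject≤ i m≤n

  embed : Square m → Square n
  embed = map ι ι

  proper-embed : ProperColouring m k (c ∘ embed)
  proper-embed (i , j) (p , q) (distinct , line) =
    proper (embed (i , j)) (embed (p , q)) (distinct′ , line′)
    where
    distinct′ : embed (i , j) ≢ embed (p , q)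
    distinct′ = distinct ∘ ×-≡,≡→≡
              ∘ map (inject≤-injective m≤n m≤n i p) (inject≤-injective m≤n m≤n j q) ∘ ×-≡,≡←≡
    line′ : Collinear (toℕ (ι i)) (toℕ (ι j)) (toℕ (ι p)) (toℕ (ι q))
    line′ rewrite toℕ-inject≤ i m≤n | toℕ-inject≤ j m≤n | toℕ-inject≤ p m≤n | toℕ-inject≤ q m≤n =
      line

∃-fun? : ∀ {ℓ m k} {P : Pred (Fin m → Fin k) ℓ} →
         (∀ {f g} → f ≗ g → P f → P g) → Decidable P → Dec (∃ P)
∃-fun? resp P? = map′ (λ (x , Px) → finToFun x , Px)
                      (λ (f , Pf) → funToFin f , resp (sym ∘ finToFun-funToFin f) Pf)
                      (any? (P? ∘ finToFun))

proper-resp : ∀ {n k c d} → c ≗ d → ProperColouring n k c → ProperColouring n k d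
proper-resp c≗d proper u v adj same = proper u v adj (trans (c≗d u) (trans same (sym (c≗d v))))

qAdj? : ∀ n u v → Dec (QAdj n u v)
qAdj? n u@(i , j) v@(p , q) =
  ¬? (≡-dec _≟ᶠ_ _≟ᶠ_ u v) ×-dec
  (toℕ i ≟ toℕ p ⊎-dec toℕ j ≟ toℕ q ⊎-dec
   toℕ i + toℕ j ≟ toℕ p + toℕ q ⊎-dec toℕ i + toℕ q ≟ toℕ p + toℕ j)

proper? : ∀ n k c → Dec (ProperColouring n k c)
proper? n k c =
  map′ (λ h (i , j) (p , q) → h i j p q) (λ h i j p q → h (i , j) (p , q))
    (all? λ i → all? λ j → all? λ p → all? λ q →
      qAdj? n (i , j) (p , q) →-dec ¬? (c (i , j) ≟ᶠ c (p , q)))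

-- A colouring of Square n is searched for as a function on Fin (n * n) ≅ Square n.
colourable? : ∀ n k → Dec (Colourable n k)
colourable? n k =
  map′ (λ (f , proper) → f ∘ uncurry combine , proper)
       (λ (c , proper) → c ∘ remQuot n ,
                         proper-resp (cong c ∘ sym ∘ uncurry remQuot-combine) proper)
       (∃-fun? (λ f≗g → proper-resp (f≗g ∘ uncurry combine))
               (λ f → proper? n k (f ∘ uncurry combine)))

¬colourable-<-suc : ∀ {n k} → (∀ m → m < k → ¬ Colourable n m) → ¬ Colourable n k →
                    ∀ m → m < suc k → ¬ Colourable n m
¬colourable-<-suc below ¬k m m<1+k with m<1+n⇒m<n∨m≡n m<1+k
... | inj₁ m<k  = below m m<k
... | inj₂ refl = ¬k

chromaticNumber-within : ∀ {n k} a → (∀ m → m < k → ¬ Colourable n m) → Colourable n (k + a) →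
                         ∃ λ e → e ≤ a × ChromaticNumber n (k + e)
chromaticNumber-within {n} {k} a below colourable with colourable? n k
... | yes k-colourable =
  0 , z≤n , subst (ChromaticNumber n) (sym (+-identityʳ k)) (k-colourable , below)
chromaticNumber-within {n} {k} zero below colourable | no ¬k-colourable =
  contradiction (subst (Colourable n) (+-identityʳ k) colourable) ¬k-colourable
chromaticNumber-within {n} {k} (suc a) below colourable | no ¬k-colourable
  with chromaticNumber-within a (¬colourable-<-suc below ¬k-colourable)
                                (subst (Colourable n) (+-suc k a) colourable)
... | e , e≤a , χ = suc e , s≤s e≤a , subst (ChromaticNumber n) (sym (+-suc k e)) χ

χ∈[n,n+a] : ∀ {n} a → Colourable n (n + a) → ∃ λ e → e ≤ a × ChromaticNumber n (n + e)
χ∈[n,n+a] a = chromaticNumber-within a (λ _ → ¬colourable-<)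

χ+0 : ∀ {n} → ChromaticNumber n (n + 0) → ChromaticNumber n n
χ+0 {n} = subst (ChromaticNumber n) (+-identityʳ n)

χ∈[n,n+1] : ∀ {n} → Colourable n (n + 1) → ChromaticNumber n n ⊎ ChromaticNumber n (n + 1)
χ∈[n,n+1] colourable with χ∈[n,n+a] 1 colourable
... | 0 , _ , χ = inj₁ (χ+0 χ)
... | 1 , _ , χ = inj₂ χ
... | suc (suc _) , s≤s () , _

χ∈[n,n+2] : ∀ {n} → Colourable n (n + 2) →
            ChromaticNumber n n ⊎ ChromaticNumber n (n + 1) ⊎ ChromaticNumber n (n + 2)
χ∈[n,n+2] colourable with χ∈[n,n+a] 2 colourable
... | 0 , _ , χ = inj₁ (χ+0 χ)
... | 1 , _ , χ = inj₂ (inj₁ χ)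
... | 2 , _ , χ = inj₂ (inj₂ χ)
... | suc (suc (suc _)) , s≤s (s≤s ()) , _

χ∈[n,n+3] : ∀ {n} → Colourable n (n + 3) →
            ChromaticNumber n n ⊎ ChromaticNumber n (n + 1)
            ⊎ ChromaticNumber n (n + 2) ⊎ ChromaticNumber n (n + 3)
χ∈[n,n+3] colourable with χ∈[n,n+a] 3 colourable
... | 0 , _ , χ = inj₁ (χ+0 χ)
... | 1 , _ , χ = inj₂ (inj₁ χ)
... | 2 , _ , χ = inj₂ (inj₂ (inj₁ χ))
... | 3 , _ , χ = inj₂ (inj₂ (inj₂ χ))
... | suc (suc (suc (suc _))) , s≤s (s≤s (s≤s ())) , _

colourable-n+a : ∀ n a .{{_ : NonZero (n + a)}} →
                 (n + a) % 6 ≡ 1 ⊎ (n + a) % 6 ≡ 5 → Colourable n (n + a)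
colourable-n+a n a residue =
  colourable-restrict (m≤m+n n a) (coprime[n,6]⇒colourable (%6≡1⊎5⇒coprime[n,6] residue))

corollary2 : (n : ℕ) → 5 ≤ n →
    ((n % 6 ≡ 1 ⊎ n % 6 ≡ 5) → ChromaticNumber n n)
    × ((n % 6 ≡ 0 ⊎ n % 6 ≡ 4) →
        ChromaticNumber n n ⊎ ChromaticNumber n (n + 1))
    × (n % 6 ≡ 2 →
        ChromaticNumber n n ⊎ ChromaticNumber n (n + 1)
        ⊎ ChromaticNumber n (n + 2) ⊎ ChromaticNumber n (n + 3))
    × (n % 6 ≡ 3 →
        ChromaticNumber n n ⊎ ChromaticNumber n (n + 1)
        ⊎ ChromaticNumber n (n + 2))
corollary2 n@(suc _) _ =
    (λ residue → coprime[n,6]⇒colourable (%6≡1⊎5⇒coprime[n,6] residue) , λ _ → ¬colourable-<)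
  , (λ where
      (inj₁ n%6≡0) → χ∈[n,n+1] (colourable-n+a n 1 (inj₁ (shift 1 n%6≡0)))
      (inj₂ n%6≡4) → χ∈[n,n+1] (colourable-n+a n 1 (inj₂ (shift 1 n%6≡4))))
  , (λ n%6≡2 → χ∈[n,n+3] (colourable-n+a n 3 (inj₂ (shift 3 n%6≡2))))
  , (λ n%6≡3 → χ∈[n,n+2] (colourable-n+a n 2 (inj₂ (shift 2 n%6≡3))))
  where
  shift : ∀ a {r} → n % 6 ≡ r → (n + a) % 6 ≡ (r + a % 6) % 6
  shift a = m%o≡r⇒[m+n]%o≡[r+n%o]%o n a 6
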